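{- Let $S$ be a subset of $\{A,B,C,D\}$ with $|S|=1$. A finite poset is an $S$-order if and only if it is a unit interval order.
   Context: Interval types: every interval $I_v$ considered has left endpoint $L(v)$, right endpoint $R(v)$ and center $c(v)=(L(v)+R(v))/2$, and is of one of four types: type $A$ (endpoints closed, center closed), type $B$ (endpoints open, center open), type $C$ (endpoints closed, center open), type $D$ (endpoints open, center closed). The words "open/closed" for the center are only labels; the center always belongs to the interval. Thus $L(v),R(v)$ are called open iff $I_v$ has type $B$ or $D$, and $c(v)$ is called open iff $I_v$ has type $B$ or $C$. For a nonempty $S\subseteq\{A,B,C,D\}$, an $S$-representation of a poset $(X,\prec)$ assigns to each $x\in X$ an interval $I_x$, all intervals having the same positive length, each of a type belonging to $S$, such that for all $x,y\in X$: $x\prec y$ if and only if (i) $R(x)<c(y)$, or (ii) $R(x)=c(y)$, at least one of $R(x),c(y)$ is open, and at least one of $L(y),c(x)$ is open. An $S$-order is a poset admitting an $S$-representation. A unit interval order is a poset $(X,\prec)$ for which each $x$ can be assigned a real interval $I_x$, all of the same length, with $x\prec y$ iff every point of $I_x$ is less than every point of $I_y$. -}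

module Defs where

open import Data.Nat using (ℕ)
open import Data.Fin using (Fin)
open import Data.Bool using (Bool; true; false)
open import Data.Product using (Σ; ∃; _×_; _,_)
open import Data.Sum using (_⊎_)
open import Relation.Binary using (Tri)
open import Relation.Binary.PropositionalEquality using (_≡_)
open import Relation.Nullary using (¬_)

-- The real numbers, given axiomatically as a complete ordered field
-- (this characterises ℝ up to unique isomorphism).

record RealField : Set₁ where
  infixl 6 _+_
  infixl 7 _*_
  infix 4 _<_ _≤_
  field
    Carrier : Set
    _+_ _*_ : Carrier → Carrier → Carrier
    -_      : Carrier → Carrier
    inv     : Carrier → Carrier
    0# 1#   : Carrier
    _<_     : Carrier → Carrier → Set
    +-assoc    : ∀ x y z → (x + y) + z ≡ x + (y + z)
    +-comm     : ∀ x y → x + y ≡ y + x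
    +-identity : ∀ x → x + 0# ≡ x
    +-inverse  : ∀ x → x + (- x) ≡ 0#
    *-assoc    : ∀ x y z → (x * y) * z ≡ x * (y * z)
    *-comm     : ∀ x y → x * y ≡ y * x
    *-identity : ∀ x → x * 1# ≡ x
    distrib    : ∀ x y z → x * (y + z) ≡ x * y + x * z
    0≢1        : ¬ (0# ≡ 1#)
    *-inverse  : ∀ x → ¬ (x ≡ 0#) → x * inv x ≡ 1#
    <-irrefl   : ∀ x → ¬ (x < x)
    <-trans    : ∀ {x y z} → x < y → y < z → x < z
    <-tri      : ∀ x y → Tri (x < y) (x ≡ y) (y < x)
    +-mono-<   : ∀ {x y} z → x < y → x + z < y + z
    *-pos      : ∀ {x y} → 0# < x → 0# < y → 0# < x * y
  _≤_ : Carrier → Carrier → Set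
  x ≤ y = (x < y) ⊎ (x ≡ y)
  field
    sup : (P : Carrier → Set) → (∃ λ x → P x) → (∃ λ b → ∀ x → P x → x ≤ b) →
          ∃ λ s → (∀ x → P x → x ≤ s) × (∀ b → (∀ x → P x → x ≤ b) → s ≤ b)

data IType : Set where
  A B C D : IType

endsOpen : IType → Bool
endsOpen A = false
endsOpen B = true
endsOpen C = false
endsOpen D = true

centerOpen : IType → Bool
centerOpen A = false
centerOpen B = true
centerOpen C = true
centerOpen D = false

module _ (ℝ : RealField) where
  open RealField ℝ

  two : Carrier
  two = 1# + 1#

  record SRepresentation (S : IType → Set) {n : ℕ}
         (_≺_ : Fin n → Fin n → Set) : Set where
    field
      ℓ   : Carrier
      ℓ>0 : 0# < ℓ
      L   : Fin n → Carrier
      τ   : Fin n → IType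
      τ∈S : ∀ x → S (τ x)
    R : Fin n → Carrier
    R x = L x + ℓ
    c : Fin n → Carrier
    c x = (L x + R x) * inv two
    field
      represents : ∀ x y →
        (x ≺ y → (R x < c y) ⊎
                 ((R x ≡ c y) ×
                  ((endsOpen (τ x) ≡ true) ⊎ (centerOpen (τ y) ≡ true)) ×
                  ((endsOpen (τ y) ≡ true) ⊎ (centerOpen (τ x) ≡ true))))
        ×
        ((R x < c y) ⊎
                 ((R x ≡ c y) ×
                  ((endsOpen (τ x) ≡ true) ⊎ (centerOpen (τ y) ≡ true)) ×
                  ((endsOpen (τ y) ≡ true) ⊎ (centerOpen (τ x) ≡ true)))
          → x ≺ y)

  SOrder : (S : IType → Set) {n : ℕ} (_≺_ : Fin n → Fin n → Set) → Set
  SOrder S _≺_ = SRepresentation S _≺_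

  -- Unit interval order: closed intervals [L x, L x + 1] with
  -- x ≺ y iff every point of I_x is below every point of I_y, i.e. L x + 1 < L y.
  UnitIntervalOrder : {n : ℕ} (_≺_ : Fin n → Fin n → Set) → Set
  UnitIntervalOrder {n} _≺_ =
    Σ (Fin n → Carrier) λ L → ∀ x y →
      (x ≺ y → L x + 1# < L y) × (L x + 1# < L y → x ≺ y)

module Submission where

-- With all intervals of one type T and common length ℓ, the centre of I_y is
-- L(y) + ℓ/2, so x ≺ y compares L(x) + ℓ/2 with L(y): strictly when T = A
-- (ties never count), and non-strictly for B, C, D (ties always count).
-- A strict comparison L(x) + h < L(y) is a unit interval order after scaling
-- by 1/h. On a finite set the two comparisons define the same relations:
-- perturbing h by less than the smallest nonzero gap L(y) − L(x) − h turns
-- one into the other.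

open import Defs
open import Data.Nat using (ℕ; zero; suc)
open import Data.Fin using (Fin; zero; suc)
open import Data.Bool using (true)
open import Data.Empty using (⊥-elim)
open import Data.Product using (∃; ∃₂; _×_; _,_; proj₁; proj₂)
open import Data.Product.Function.NonDependent.Propositional using (_×-⇔_)
open import Data.Sum using (_⊎_; inj₁; inj₂; [_,_])
open import Data.Sum.Function.Propositional using (_⊎-⇔_)
open import Function.Base using (id; const)
open import Function.Bundles using (_⇔_; mk⇔; module Equivalence)
open import Function.Properties.Equivalence as ⇔ using (⇔-setoid)
open import Level using (0ℓ)
open import Relation.Binary using (tri<; tri≈; tri>)
open import Relation.Binary.PropositionalEquality
  using (_≡_; refl; sym; trans; cong; cong₂; subst; subst₂; module ≡-Reasoning)
open import Relation.Binary.Structures using (IsStrictPartialOrder)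
open import Relation.Nullary using (¬_; Dec; yes; no)
import Relation.Binary.Reasoning.Setoid as SetoidReasoning

TieBreaks : IType → Set
TieBreaks T = endsOpen T ≡ true ⊎ centerOpen T ≡ true

tieBreaks? : ∀ T → Dec (TieBreaks T)
tieBreaks? A = no λ { (inj₁ ()) ; (inj₂ ()) }
tieBreaks? B = yes (inj₁ refl)
tieBreaks? C = yes (inj₂ refl)
tieBreaks? D = yes (inj₁ refl)

tie-condition-of-type : ∀ {a b T} → a ≡ T → b ≡ T →
  ((endsOpen a ≡ true ⊎ centerOpen b ≡ true) × (endsOpen b ≡ true ⊎ centerOpen a ≡ true))
    ⇔ (TieBreaks T × TieBreaks T)
tie-condition-of-type refl refl = mk⇔ id id

module OrderedField (ℝ : RealField) where
  open RealField ℝ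
  open ≡-Reasoning

  infixl 6 _-_
  _-_ : Carrier → Carrier → Carrier
  x - y = x + (- y)

  _<?_ : ∀ x y → Dec (x < y)
  x <? y with <-tri x y
  ... | tri< x<y _ _ = yes x<y
  ... | tri≈ x≮y _ _ = no x≮y
  ... | tri> x≮y _ _ = no x≮y

  <-≤-trans : ∀ {x y z} → x < y → y ≤ z → x < z
  <-≤-trans x<y (inj₁ y<z) = <-trans x<y y<z
  <-≤-trans x<y (inj₂ refl) = x<y

  +-identityˡ : ∀ x → 0# + x ≡ x
  +-identityˡ x = trans (+-comm 0# x) (+-identity x)

  x+y-y≡x : ∀ x y → x + y - y ≡ x
  x+y-y≡x x y = begin
    x + y + - y   ≡⟨ +-assoc x y (- y) ⟩
    x + (y - y)   ≡⟨ cong (x +_) (+-inverse y) ⟩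
    x + 0#        ≡⟨ +-identity x ⟩
    x             ∎

  x+[y-x]≡y : ∀ x y → x + (y - x) ≡ y
  x+[y-x]≡y x y = begin
    x + (y + - x)   ≡⟨ cong (x +_) (+-comm y (- x)) ⟩
    x + (- x + y)   ≡⟨ +-assoc x (- x) y ⟨
    x - x + y       ≡⟨ cong (_+ y) (+-inverse x) ⟩
    0# + y          ≡⟨ +-identityˡ y ⟩
    y               ∎

  +-cancelʳ-≡ : ∀ {x y} z → x + z ≡ y + z → x ≡ y
  +-cancelʳ-≡ {x} {y} z e = begin
    x           ≡⟨ x+y-y≡x x z ⟨
    x + z - z   ≡⟨ cong (_- z) e ⟩
    y + z - z   ≡⟨ x+y-y≡x y z ⟩
    y           ∎

  +-cancelʳ-< : ∀ {x y} z → x + z < y + z → x < y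
  +-cancelʳ-< {x} {y} z p = subst₂ _<_ (x+y-y≡x x z) (x+y-y≡x y z) (+-mono-< (- z) p)

  +-monoʳ-< : ∀ {x y} z → x < y → z + x < z + y
  +-monoʳ-< {x} {y} z p = subst₂ _<_ (+-comm x z) (+-comm y z) (+-mono-< z p)

  x<x+y : ∀ x {y} → 0# < y → x < x + y
  x<x+y x {y} 0<y = subst (_< x + y) (+-identity x) (+-monoʳ-< x 0<y)

  x-y+y≡x : ∀ x y → x - y + y ≡ x
  x-y+y≡x x y = begin
    x + - y + y     ≡⟨ +-assoc x (- y) y ⟩
    x + (- y + y)   ≡⟨ cong (x +_) (+-comm (- y) y) ⟩
    x + (y - y)     ≡⟨ cong (x +_) (+-inverse y) ⟩
    x + 0#          ≡⟨ +-identity x ⟩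
    x               ∎

  x-y<x : ∀ x {y} → 0# < y → x - y < x
  x-y<x x {y} 0<y = subst (x - y <_) (x-y+y≡x x y) (x<x+y (x - y) 0<y)

  <⇒0<diff : ∀ {x y} → x < y → 0# < y - x
  <⇒0<diff {x} {y} x<y = subst (_< y - x) (+-inverse x) (+-mono-< (- x) x<y)

  distribʳ : ∀ x y z → (y + z) * x ≡ y * x + z * x
  distribʳ x y z = trans (*-comm (y + z) x) (trans (distrib x y z) (cong₂ _+_ (*-comm x y) (*-comm x z)))

  *-zeroʳ : ∀ x → x * 0# ≡ 0#
  *-zeroʳ x = sym (+-cancelʳ-≡ (x * 0#) (begin
    0# + x * 0#       ≡⟨ +-identityˡ (x * 0#) ⟩
    x * 0#            ≡⟨ cong (x *_) (+-identity 0#) ⟨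
    x * (0# + 0#)     ≡⟨ distrib x 0# 0# ⟩
    x * 0# + x * 0#   ∎))

  *-zeroˡ : ∀ x → 0# * x ≡ 0#
  *-zeroˡ x = trans (*-comm 0# x) (*-zeroʳ x)

  -1*-1≡1 : (- 1#) * (- 1#) ≡ 1#
  -1*-1≡1 = +-cancelʳ-≡ (- 1#) (begin
    (- 1#) * (- 1#) + - 1#          ≡⟨ cong ((- 1#) * (- 1#) +_) (*-identity (- 1#)) ⟨
    (- 1#) * (- 1#) + (- 1#) * 1#   ≡⟨ distrib (- 1#) (- 1#) 1# ⟨
    (- 1#) * (- 1# + 1#)            ≡⟨ cong ((- 1#) *_) (trans (+-comm (- 1#) 1#) (+-inverse 1#)) ⟩
    (- 1#) * 0#                     ≡⟨ *-zeroʳ (- 1#) ⟩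
    0#                              ≡⟨ +-inverse 1# ⟨
    1# - 1#                         ∎)

  -- If 1 < 0 then 0 < -1, and then 0 < (-1)(-1) = 1.
  0<1 : 0# < 1#
  0<1 with <-tri 0# 1#
  ... | tri< 0<1 _ _ = 0<1
  ... | tri≈ _ 0≡1 _ = ⊥-elim (0≢1 0≡1)
  ... | tri> _ _ 1<0 = ⊥-elim (<-irrefl 0# (<-trans (subst (0# <_) -1*-1≡1 (*-pos 0<-1 0<-1)) 1<0))
    where
    0<-1 : 0# < - 1#
    0<-1 = subst₂ _<_ (+-inverse 1#) (+-identityˡ (- 1#)) (+-mono-< (- 1#) 1<0)

  *-monoʳ-< : ∀ {x y z} → 0# < z → x < y → x * z < y * z
  *-monoʳ-< {x} {y} {z} 0<z x<y = subst (x * z <_) split (x<x+y (x * z) (*-pos (<⇒0<diff x<y) 0<z))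
    where
    split : x * z + (y - x) * z ≡ y * z
    split = trans (sym (distribʳ z x (y - x))) (cong (_* z) (x+[y-x]≡y x y))

  *-cancelʳ-< : ∀ {x y z} → 0# < z → x * z < y * z → x < y
  *-cancelʳ-< {x} {y} 0<z xz<yz with <-tri x y
  ... | tri< x<y _ _ = x<y
  ... | tri≈ _ refl _ = ⊥-elim (<-irrefl _ xz<yz)
  ... | tri> _ _ y<x = ⊥-elim (<-irrefl _ (<-trans xz<yz (*-monoʳ-< 0<z y<x)))

  0<⇒≢0 : ∀ {x} → 0# < x → ¬ (x ≡ 0#)
  0<⇒≢0 0<x refl = <-irrefl 0# 0<x

  inv-pos : ∀ {x} → 0# < x → 0# < inv x
  inv-pos {x} 0<x with <-tri 0# (inv x)
  ... | tri< 0<x⁻¹ _ _ = 0<x⁻¹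
  ... | tri≈ _ 0≡x⁻¹ _ = ⊥-elim (0≢1 (begin
    0#           ≡⟨ *-zeroʳ x ⟨
    x * 0#       ≡⟨ cong (x *_) 0≡x⁻¹ ⟩
    x * inv x    ≡⟨ *-inverse x (0<⇒≢0 0<x) ⟩
    1#           ∎))
  ... | tri> _ _ x⁻¹<0 = ⊥-elim (<-irrefl 0# (<-trans 0<1 1<0))
    where
    1<0 : 1# < 0#
    1<0 = subst₂ _<_ (trans (*-comm (inv x) x) (*-inverse x (0<⇒≢0 0<x))) (*-zeroˡ x)
                     (*-monoʳ-< 0<x x⁻¹<0)

  half : Carrier → Carrier
  half x = x * inv (two ℝ)

  0<two : 0# < two ℝ
  0<two = <-trans 0<1 (x<x+y 1# 0<1)

  half-pos : ∀ {x} → 0# < x → 0# < half x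
  half-pos 0<x = *-pos 0<x (inv-pos 0<two)

  half-+-half : ∀ x → half x + half x ≡ x
  half-+-half x = begin
    half x + half x              ≡⟨ cong₂ _+_ (*-identity (half x)) (*-identity (half x)) ⟨
    half x * 1# + half x * 1#    ≡⟨ distrib (half x) 1# 1# ⟨
    half x * two ℝ               ≡⟨ *-assoc x (inv (two ℝ)) (two ℝ) ⟩
    x * (inv (two ℝ) * two ℝ)    ≡⟨ cong (x *_) (*-comm (inv (two ℝ)) (two ℝ)) ⟩
    x * (two ℝ * inv (two ℝ))    ≡⟨ cong (x *_) (*-inverse (two ℝ) (0<⇒≢0 0<two)) ⟩
    x * 1#                       ≡⟨ *-identity x ⟩
    x                            ∎

  half-double : ∀ x → half (x + x) ≡ x
  half-double x = trans (distribʳ (inv (two ℝ)) x x) (half-+-half x)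

  half-< : ∀ {x} → 0# < x → half x < x
  half-< {x} 0<x = subst (half x <_) (half-+-half x) (x<x+y (half x) (half-pos 0<x))

  x+y≡x+½y+½y : ∀ x y → x + y ≡ x + half y + half y
  x+y≡x+½y+½y x y = trans (cong (x +_) (sym (half-+-half y))) (sym (+-assoc x (half y) (half y)))

  half[x+[x+y]]≡x+½y : ∀ x y → half (x + (x + y)) ≡ x + half y
  half[x+[x+y]]≡x+½y x y = begin
    half (x + (x + y))         ≡⟨ cong half (+-assoc x x y) ⟨
    half (x + x + y)           ≡⟨ distribʳ (inv (two ℝ)) (x + x) y ⟩
    half (x + x) + half y      ≡⟨ cong (_+ half y) (half-double x) ⟩
    x + half y                 ∎

  ∃-positive-≤ : ∀ {x y} → 0# < x → 0# < y → ∃ λ m → 0# < m × m ≤ x × m ≤ y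
  ∃-positive-≤ {x} {y} 0<x 0<y with <-tri x y
  ... | tri< x<y _ _ = x , 0<x , inj₂ refl , inj₁ x<y
  ... | tri≈ _ x≡y _ = x , 0<x , inj₂ refl , inj₂ x≡y
  ... | tri> _ _ y<x = y , 0<y , inj₁ y<x , inj₂ refl

  ∃-below-positives : ∀ {m} (g : Fin m → Carrier) {b} → 0# < b →
    ∃ λ δ → 0# < δ × δ < b × (∀ i → 0# < g i → δ < g i)
  ∃-below-positives {zero} g {b} 0<b = half b , half-pos 0<b , half-< 0<b , λ ()
  ∃-below-positives {suc m} g 0<b with 0# <? g zero
  ... | yes 0<g₀ =
    let (b′ , 0<b′ , b′≤b , b′≤g₀) = ∃-positive-≤ 0<b 0<g₀
        (δ , 0<δ , δ<b′ , below) = ∃-below-positives (λ i → g (suc i)) 0<b′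
    in δ , 0<δ , <-≤-trans δ<b′ b′≤b , λ { zero _ → <-≤-trans δ<b′ b′≤g₀ ; (suc i) → below i }
  ... | no 0≮g₀ =
    let (δ , 0<δ , δ<b , below) = ∃-below-positives (λ i → g (suc i)) 0<b
    in δ , 0<δ , δ<b , λ { zero 0<g₀ → ⊥-elim (0≮g₀ 0<g₀) ; (suc i) → below i }

  ∃-below-positives₂ : ∀ {m k} (g : Fin m → Fin k → Carrier) {b} → 0# < b →
    ∃ λ δ → 0# < δ × δ < b × (∀ i j → 0# < g i j → δ < g i j)
  ∃-below-positives₂ g {b} 0<b =
    let (δ , 0<δ , δ<b , below) = ∃-below-positives (λ i → proj₁ (row i)) 0<b
    in δ , 0<δ , δ<b , λ i j 0<gᵢⱼ →
         let (_ , 0<δᵢ , _ , belowᵢ) = row i in <-trans (below i 0<δᵢ) (belowᵢ j 0<gᵢⱼ)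
    where
    row : ∀ i → ∃ λ δ → 0# < δ × δ < b × (∀ j → 0# < g i j → δ < g i j)
    row i = ∃-below-positives (g i) 0<b

  widen-threshold : ∀ {x h y δ} → 0# < δ → (0# < y - (x + h) → δ < y - (x + h)) →
    (x + h < y) ⇔ (x + (h + δ) ≤ y)
  widen-threshold {x} {h} {y} {δ} 0<δ below = mk⇔ widen narrow
    where
    widen : x + h < y → x + (h + δ) ≤ y
    widen x+h<y = inj₁ (subst₂ _<_ (+-assoc x h δ) (x+[y-x]≡y (x + h) y)
                                   (+-monoʳ-< (x + h) (below (<⇒0<diff x+h<y))))
    narrow : x + (h + δ) ≤ y → x + h < y
    narrow = <-≤-trans (+-monoʳ-< x (x<x+y h 0<δ))

  narrow-threshold : ∀ {x h y δ} → 0# < δ → (0# < x + h - y → δ < x + h - y) →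
    (x + h ≤ y) ⇔ (x + (h - δ) < y)
  narrow-threshold {x} {h} {y} {δ} 0<δ below = mk⇔ narrow widen
    where
    narrow : x + h ≤ y → x + (h - δ) < y
    narrow = <-≤-trans (subst (_< x + h) (+-assoc x h (- δ)) (x-y<x (x + h) 0<δ))
    widen : x + (h - δ) < y → x + h ≤ y
    widen x+h-δ<y with <-tri (x + h) y
    ... | tri< x+h<y _ _ = inj₁ x+h<y
    ... | tri≈ _ x+h≡y _ = inj₂ x+h≡y
    ... | tri> _ _ y<x+h = ⊥-elim (<-irrefl y (<-trans y<x+h-δ x+h-δ<y))
      where
      y+δ<x+h : y + δ < x + h
      y+δ<x+h = subst (y + δ <_) (x+[y-x]≡y y (x + h)) (+-monoʳ-< y (below (<⇒0<diff y<x+h)))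
      y<x+h-δ : y < x + (h - δ)
      y<x+h-δ = subst₂ _<_ (x+y-y≡x y δ) (+-assoc x h (- δ)) (+-mono-< (- δ) y+δ<x+h)

  scale-threshold : ∀ {x h y} → 0# < h → (x + h < y) ⇔ (x * inv h + 1# < y * inv h)
  scale-threshold {x} {h} {y} 0<h = mk⇔
    (λ x+h<y → subst (_< y * inv h) scaled (*-monoʳ-< (inv-pos 0<h) x+h<y))
    (λ p → *-cancelʳ-< (inv-pos 0<h) (subst (_< y * inv h) (sym scaled) p))
    where
    scaled : (x + h) * inv h ≡ x * inv h + 1#
    scaled = trans (distribʳ (inv h) x h) (cong (x * inv h +_) (*-inverse h (0<⇒≢0 0<h)))

  _◃[_]_ : Carrier → IType → Carrier → Set
  x ◃[ T ] y = x < y ⊎ (x ≡ y × TieBreaks T × TieBreaks T)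

  ◃-untied : ∀ {T} → ¬ TieBreaks T → ∀ x y → x ◃[ T ] y ⇔ x < y
  ◃-untied ¬tie x y = mk⇔ [ id , (λ (_ , tie , _) → ⊥-elim (¬tie tie)) ] inj₁

  ◃-tied : ∀ {T} → TieBreaks T → ∀ x y → x ◃[ T ] y ⇔ x ≤ y
  ◃-tied tie x y = mk⇔ [ inj₁ , (λ (x≡y , _) → inj₂ x≡y) ] [ inj₁ , (λ x≡y → inj₂ (x≡y , tie , tie)) ]

  right-vs-centre : ∀ {P Q : Set} x y ℓ → P ⇔ Q →
    (x + ℓ < half (y + (y + ℓ)) ⊎ (x + ℓ ≡ half (y + (y + ℓ)) × P))
      ⇔ (x + half ℓ < y ⊎ (x + half ℓ ≡ y × Q))
  right-vs-centre x y ℓ P⇔Q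
    rewrite x+y≡x+½y+½y x ℓ | half[x+[x+y]]≡x+½y y ℓ =
    mk⇔ (+-cancelʳ-< (half ℓ)) (+-mono-< (half ℓ))
      ⊎-⇔ (mk⇔ (+-cancelʳ-≡ (half ℓ)) (cong (_+ half ℓ)) ×-⇔ P⇔Q)

module Representations (ℝ : RealField) {n : ℕ} (_≺_ : Fin n → Fin n → Set) where
  open RealField ℝ
  open OrderedField ℝ

  IsThreshold : (Carrier → Carrier → Set) → Carrier → (Fin n → Carrier) → Set
  IsThreshold _◃_ h L = ∀ x y → x ≺ y ⇔ (L x + h) ◃ L y

  Threshold : (Carrier → Carrier → Set) → Set
  Threshold _◃_ = ∃₂ λ h L → 0# < h × IsThreshold _◃_ h L

  threshold-cong : ∀ {_◃_ _◃′_} → (∀ x y → x ◃ y ⇔ x ◃′ y) → Threshold _◃_ ⇔ Threshold _◃′_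
  threshold-cong ◃⇔◃′ = mk⇔
    (λ (h , L , 0<h , φ) → h , L , 0<h , λ x y → ⇔.trans (φ x y) (◃⇔◃′ _ _))
    (λ (h , L , 0<h , φ) → h , L , 0<h , λ x y → ⇔.trans (φ x y) (⇔.sym (◃⇔◃′ _ _)))

  unitIntervalOrder⇔strictThreshold : UnitIntervalOrder ℝ _≺_ ⇔ Threshold _<_
  unitIntervalOrder⇔strictThreshold = mk⇔
    (λ (L , φ) → 1# , L , 0<1 , λ x y → mk⇔ (proj₁ (φ x y)) (proj₂ (φ x y)))
    (λ (h , L , 0<h , φ) → (λ x → L x * inv h) , λ x y →
       let open Equivalence (⇔.trans (φ x y) (scale-threshold 0<h)) in to , from)

  -- Finiteness is used here: δ lies below every positive gap between thresholds.
  strict⇒weak : Threshold _<_ → Threshold _≤_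
  strict⇒weak (h , L , 0<h , φ) =
    let (δ , 0<δ , _ , below) = ∃-below-positives₂ (λ x y → L y - (L x + h)) 0<h
    in h + δ , L , <-trans 0<h (x<x+y h 0<δ) , λ x y → ⇔.trans (φ x y) (widen-threshold 0<δ (below x y))

  weak⇒strict : Threshold _≤_ → Threshold _<_
  weak⇒strict (h , L , 0<h , φ) =
    let (δ , 0<δ , δ<h , below) = ∃-below-positives₂ (λ x y → L x + h - L y) 0<h
    in h - δ , L , <⇒0<diff δ<h , λ x y → ⇔.trans (φ x y) (narrow-threshold 0<δ (below x y))

  sOrder⇔threshold : ∀ T → SOrder ℝ (_≡ T) _≺_ ⇔ Threshold (_◃[ T ]_)
  sOrder⇔threshold T = mk⇔ threshold sRepresentation
    where
    threshold : SOrder ℝ (_≡ T) _≺_ → Threshold (_◃[ T ]_)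
    threshold r = half ℓ , L , half-pos ℓ>0 , λ x y →
      ⇔.trans (mk⇔ (proj₁ (represents x y)) (proj₂ (represents x y)))
              (right-vs-centre (L x) (L y) ℓ (tie-condition-of-type (τ∈S x) (τ∈S y)))
      where open SRepresentation r

    sRepresentation : Threshold (_◃[ T ]_) → SOrder ℝ (_≡ T) _≺_
    sRepresentation (h , L , 0<h , φ) = record
      { ℓ = h + h
      ; ℓ>0 = <-trans 0<h (x<x+y h 0<h)
      ; L = L
      ; τ = const T
      ; τ∈S = λ _ → refl
      ; represents = λ x y →
          let open Equivalence (⇔.trans (φ′ x y) (⇔.sym (right-vs-centre (L x) (L y) (h + h) ⇔.refl)))
          in to , from
      }
      where
      φ′ : IsThreshold (_◃[ T ]_) (half (h + h)) L
      φ′ = subst (λ k → IsThreshold (_◃[ T ]_) k L) (sym (half-double h)) φ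

theorem2 : (ℝ : RealField) (T : IType) (n : ℕ) (_≺_ : Fin n → Fin n → Set) →
    IsStrictPartialOrder _≡_ _≺_ →
    SOrder ℝ (_≡ T) _≺_ ⇔ UnitIntervalOrder ℝ _≺_
theorem2 ℝ T n _≺_ _ with tieBreaks? T
... | no ¬tie = begin
  SOrder ℝ (_≡ T) _≺_       ≈⟨ sOrder⇔threshold T ⟩
  Threshold (_◃[ T ]_)      ≈⟨ threshold-cong (◃-untied ¬tie) ⟩
  Threshold _<_             ≈⟨ unitIntervalOrder⇔strictThreshold ⟨
  UnitIntervalOrder ℝ _≺_   ∎
  where
  open RealField ℝ using (_<_)
  open OrderedField ℝ using (_◃[_]_; ◃-untied)
  open Representations ℝ _≺_
  open SetoidReasoning (⇔-setoid 0ℓ)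
... | yes tie = begin
  SOrder ℝ (_≡ T) _≺_       ≈⟨ sOrder⇔threshold T ⟩
  Threshold (_◃[ T ]_)      ≈⟨ threshold-cong (◃-tied tie) ⟩
  Threshold _≤_             ≈⟨ mk⇔ weak⇒strict strict⇒weak ⟩
  Threshold _<_             ≈⟨ unitIntervalOrder⇔strictThreshold ⟨
  UnitIntervalOrder ℝ _≺_   ∎
  where
  open RealField ℝ using (_<_; _≤_)
  open OrderedField ℝ using (_◃[_]_; ◃-tied)
  open Representations ℝ _≺_
  open SetoidReasoning (⇔-setoid 0ℓ)
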